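{- Let $\mathcal{G}$ be a hereditary class of graphs. If every blowup of every prime graph in $\mathcal{G}$ is recolorable, then every graph in $\mathcal{G}$ is recolorable.
   Context: Graphs are finite and simple. A class of graphs is hereditary if it is closed under taking induced subgraphs. A $k$-coloring of $G$ is a map $V(G)\to\{1,\dots,k\}$ giving adjacent vertices different colors; $\chi(G)$ is the least $k$ for which one exists. $R_k(G)$ is the graph whose vertices are the $k$-colorings of $G$, two being adjacent if they differ on exactly one vertex. $G$ is $k$-mixing if $R_k(G)$ is connected, and $G$ is recolorable if $G$ is $\ell$-mixing for every $\ell\ge\chi(G)+1$. A module of $G$ is a non-empty $S\subseteq V(G)$ such that every vertex outside $S$ is adjacent to all or none of $S$; it is non-trivial if it is a proper subset of $V(G)$ with at least two vertices; $G$ is prime if it has no non-trivial module. A blowup of a graph $G$ is a graph obtained from $G$ by substituting non-empty cliques for some of its vertices (substituting a clique $K$ for a vertex $v$ means deleting $v$ and adding $K$ with every vertex of $K$ adjacent to every former neighbor of $v$). -}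

module Defs where

open import Data.Nat using (ℕ; _<_; _≤_; suc)
open import Data.Fin using (Fin)
open import Data.Bool using (Bool; true; false)
open import Data.Product using (Σ; ∃; _×_; _,_)
open import Data.Sum using (_⊎_)
open import Relation.Nullary using (¬_)
open import Relation.Binary.PropositionalEquality using (_≡_; _≢_)
open import Relation.Binary.Construct.Closure.ReflexiveTransitive using (Star)
open import Function.Definitions using (Injective)

record Graph : Set where
  field
    n      : ℕ
    adj    : Fin n → Fin n → Bool
    adj-sym    : ∀ u v → adj u v ≡ adj v u
    adj-irrefl : ∀ v → adj v v ≡ false
open Graph public

Adj : (G : Graph) → Fin (n G) → Fin (n G) → Set
Adj G u v = adj G u v ≡ true

induced : (G : Graph) (m : ℕ) (f : Fin m → Fin (n G)) → Graph
induced G m f = record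
  { n = m
  ; adj = λ i j → adj G (f i) (f j)
  ; adj-sym = λ i j → adj-sym G (f i) (f j)
  ; adj-irrefl = λ i → adj-irrefl G (f i)
  }

-- A class of graphs is hereditary if closed under induced subgraphs
-- (this includes isomorphic copies, via bijective f).
Hereditary : (Graph → Set) → Set
Hereditary 𝒢 = ∀ G → 𝒢 G → ∀ m (f : Fin m → Fin (n G)) →
  Injective _≡_ _≡_ f → 𝒢 (induced G m f)

IsColoring : (G : Graph) (k : ℕ) → (Fin (n G) → Fin k) → Set
IsColoring G k c = ∀ u v → Adj G u v → c u ≢ c v

Coloring : Graph → ℕ → Set
Coloring G k = Σ (Fin (n G) → Fin k) (IsColoring G k)

Colorable : Graph → ℕ → Set
Colorable G k = Coloring G k

IsChromaticNumber : Graph → ℕ → Set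
IsChromaticNumber G k = Colorable G k × (∀ j → j < k → ¬ Colorable G j)

RAdj : (G : Graph) (k : ℕ) → Coloring G k → Coloring G k → Set
RAdj G k (α , _) (β , _) =
  ∃ λ v → (α v ≢ β v) × (∀ u → u ≢ v → α u ≡ β u)

Mixing : Graph → ℕ → Set
Mixing G k = ∀ (α β : Coloring G k) → Star (RAdj G k) α β

Recolorable : Graph → Set
Recolorable G = ∀ χ ℓ → IsChromaticNumber G χ → suc χ ≤ ℓ → Mixing G ℓ

IsModule : (G : Graph) → (Fin (n G) → Bool) → Set
IsModule G S = (∃ λ v → S v ≡ true) ×
  (∀ w → S w ≡ false →
     (∀ s → S s ≡ true → Adj G w s) ⊎ (∀ s → S s ≡ true → ¬ Adj G w s))

NonTrivialModule : (G : Graph) → (Fin (n G) → Bool) → Set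
NonTrivialModule G S = IsModule G S
  × (∃ λ w → S w ≡ false)
  × (∃ λ u → ∃ λ v → u ≢ v × S u ≡ true × S v ≡ true)

Prime : Graph → Set
Prime G = ∀ (S : Fin (n G) → Bool) → ¬ NonTrivialModule G S

-- B is (isomorphic to) a blowup of H: there is a surjection φ : V(B) → V(H)
-- whose fibres are the non-empty cliques substituted for the vertices of H,
-- and distinct fibres are joined exactly as in H.
IsBlowupOf : Graph → Graph → Set
IsBlowupOf B H = Σ (Fin (n B) → Fin (n H)) λ φ →
    (∀ x → ∃ λ u → φ u ≡ x)
  × (∀ u v → φ u ≡ φ v → u ≢ v → Adj B u v)
  × (∀ u v → φ u ≢ φ v → adj B u v ≡ adj H (φ u) (φ v))

{-# OPTIONS --safe #-}
-- Induct on |H| to show that every blowup B of every H ∈ 𝒢 is recolorable; for prime H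
-- this is the hypothesis. Otherwise a non-trivial module S of H pulls back to a module M
-- of B. Then B[M] is a blowup of H[S], and B with M replaced by a clique on k = χ(B[M])
-- vertices is a blowup of H with S shrunk to a single vertex; both H[S] and the shrunk
-- graph are proper induced subgraphs of H, hence smaller members of 𝒢.
--
-- So it suffices that G is recolorable when G[M] and the contraction G/M (M replaced by
-- the clique K_k) are. G/M has the same chromatic number χ as G. Call colorings c and d
-- jointly proper if both are proper and c u ≠ d v on every edge uv; then d is reached
-- from c by recoloring the vertices one at a time. Let α be an ℓ-coloring with ℓ > χ.
-- If more than k colors are unused on the outside neighbours of M, then G[M] is mixing
-- on them and α is linked to a coloring that factors through G/M along an optimal
-- coloring of G[M]. If exactly k are unused, α itself factors through G/M, and moving
-- inside G/M to a coloring that misses a color frees k + 1 colors. Mixing of G/M then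
-- links any two colorings that factor through it.

module Submission where

open import Defs
open import Data.Bool as Bool using (Bool; true; false; not)
open import Data.Bool.Properties using (¬-not)
open import Data.Empty using (⊥-elim)
open import Data.Fin as Fin
  using (Fin; zero; suc; toℕ; splitAt; join; _↑ˡ_; _↑ʳ_; inject≤; fromℕ<; cast)
open import Data.Fin.Properties as FinP using (any?; all?; _≟_; injective⇒≤)
import Data.Fin.Permutation.Components as PermutationComponents
open import Data.Nat as ℕ using (ℕ; zero; suc; _+_; _<_; _≤_; z≤n; s≤s)
import Data.Nat.Properties as ℕP
open import Data.Product using (∃; ∃₂; _×_; _,_; proj₁; proj₂)
open import Data.Sum as Sum using (_⊎_; inj₁; inj₂; [_,_]′)
open import Data.Vec.Functional using (_∷_)
open import Function using (_∘_; id; _⇔_; mk⇔; Equivalence)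
open import Function.Definitions using (Injective)
open import Level using (0ℓ)
open import Relation.Binary using (Rel; IsEquivalence; Setoid; _Respects₂_)
import Relation.Binary.Construct.On as On
open import Relation.Binary.Construct.Closure.ReflexiveTransitive
  using (Star; ε; _◅_; _◅◅_; gmap; reverse)
open import Relation.Binary.PropositionalEquality
open import Relation.Nullary using (¬_; Dec; yes; no; does)
open import Relation.Nullary.Decidable
  using (map′; ¬?; _×-dec_; _⊎-dec_; _→-dec_; decidable-stable; dec-true; dec-false)
open import Relation.Unary using (Decidable)

-- Enumeration and exhaustive search

record Enumeration {N : ℕ} (P : Fin N → Set) : Set where
  field
    size            : ℕ
    embed           : Fin size → Fin N
    embed-injective : Injective _≡_ _≡_ embed
    embed-∈         : ∀ i → P (embed i)
    index           : ∀ {v} → P v → Fin size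
    embed-index     : ∀ {v} (p : P v) → embed (index p) ≡ v
    size<           : ∀ {v} → ¬ P v → size < N

  injective⇒≤size : ∀ {m} {f : Fin m → Fin N} → Injective _≡_ _≡_ f → (∀ i → P (f i)) →
    m ≤ size
  injective⇒≤size {f = f} f-injective f-∈ = injective⇒≤ λ {i} {j} e → f-injective (begin
    f i                       ≡⟨ embed-index (f-∈ i) ⟨
    embed (index (f-∈ i))     ≡⟨ cong embed e ⟩
    embed (index (f-∈ j))     ≡⟨ embed-index (f-∈ j) ⟩
    f j                       ∎)
    where open ≡-Reasoning

module _ {N : ℕ} {P : Fin (suc N) → Set} (E : Enumeration (P ∘ suc)) where
  open Enumeration E

  enumeration-cons : P zero → Enumeration P
  enumeration-cons p₀ = record
    { size = suc size ; embed = embed′ ; embed-injective = injective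
    ; embed-∈ = λ { zero → p₀ ; (suc i) → embed-∈ i }
    ; index = index′ ; embed-index = embed-index′
    ; size< = λ { {zero} ¬p₀ → ⊥-elim (¬p₀ p₀) ; {suc _} ¬p → s≤s (size< ¬p) } }
    where
    embed′ : Fin (suc size) → Fin (suc N)
    embed′ = zero ∷ suc ∘ embed
    injective : Injective _≡_ _≡_ embed′
    injective {zero}  {zero}  _ = refl
    injective {suc _} {suc _} e = cong suc (embed-injective (FinP.suc-injective e))
    index′ : ∀ {v} → P v → Fin (suc size)
    index′ {zero}  _ = zero
    index′ {suc _} p = suc (index p)
    embed-index′ : ∀ {v} (p : P v) → embed′ (index′ p) ≡ v
    embed-index′ {zero}  _ = refl
    embed-index′ {suc _} p = cong suc (embed-index p)

  enumeration-skip : ¬ P zero → Enumeration P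
  enumeration-skip ¬p₀ = record
    { size = size ; embed = suc ∘ embed
    ; embed-injective = embed-injective ∘ FinP.suc-injective
    ; embed-∈ = embed-∈ ; index = index′ ; embed-index = embed-index′
    ; size< = λ _ → s≤s (injective⇒≤ embed-injective) }
    where
    index′ : ∀ {v} → P v → Fin size
    index′ {zero}  p = ⊥-elim (¬p₀ p)
    index′ {suc _} p = index p
    embed-index′ : ∀ {v} (p : P v) → suc (embed (index′ p)) ≡ v
    embed-index′ {zero}  p = ⊥-elim (¬p₀ p)
    embed-index′ {suc _} p = cong suc (embed-index p)

enumerate : ∀ {N} {P : Fin N → Set} → Decidable P → Enumeration P
enumerate {zero} _ = record
  { size = 0 ; embed = λ () ; embed-injective = λ { {()} } ; embed-∈ = λ ()
  ; index = λ { {()} } ; embed-index = λ { {()} } ; size< = λ { {()} } }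
enumerate {suc N} P? with P? zero
... | yes p₀ = enumeration-cons (enumerate (P? ∘ suc)) p₀
... | no ¬p₀ = enumeration-skip (enumerate (P? ∘ suc)) ¬p₀

Searchable : Set → Set₁
Searchable A = ∀ {Q : A → Set} → Decidable Q → Dec (∃ Q)

Bool-searchable : Searchable Bool
Bool-searchable Q? with Q? true | Q? false
... | yes q | _     = yes (true , q)
... | no _  | yes q = yes (false , q)
... | no ¬t | no ¬f = no λ { (true , q) → ¬t q ; (false , q) → ¬f q }

Extensional : ∀ {N} {A : Set} → ((Fin N → A) → Set) → Set
Extensional P = ∀ {f g} → f ≗ g → P f → P g

functions-searchable : ∀ {A : Set} → Searchable A → ∀ N {P : (Fin N → A) → Set} →
  Extensional P → Decidable P → Dec (∃ P)
functions-searchable {A} search zero P-ext P? =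
  map′ (λ p → empty , p) (λ (f , p) → P-ext (λ ()) p) (P? empty)
  where
  empty : Fin 0 → A
  empty ()
functions-searchable search (suc N) P-ext P? =
  map′ (λ (a , f , p) → a ∷ f , p) (λ (f , p) → f zero , f ∘ suc , P-ext head∷tail p)
    (search λ a → functions-searchable search N (P-ext ∘ cons-cong) (P? ∘ (a ∷_)))
  where
  head∷tail : ∀ {f} → f ≗ f zero ∷ f ∘ suc
  head∷tail zero    = refl
  head∷tail (suc _) = refl
  cons-cong : ∀ {a f g} → f ≗ g → a ∷ f ≗ a ∷ g
  cons-cong f≗g zero    = refl
  cons-cong f≗g (suc i) = f≗g i

Least : (ℕ → Set) → ℕ → Set
Least P k = P k × (∀ j → j < k → ¬ P j)

least-below : ∀ {P : ℕ → Set} → Decidable P → ∀ N → ∃ (Least P) ⊎ (∀ j → j < N → ¬ P j)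
least-below P? zero = inj₂ λ _ ()
least-below P? (suc N) with least-below P? N
... | inj₁ found = inj₁ found
... | inj₂ none with P? N
...   | yes p = inj₁ (N , p , none)
...   | no ¬p = inj₂ λ j j<1+N → [ none j , (λ { refl → ¬p }) ]′ (ℕP.m<1+n⇒m<n∨m≡n j<1+N)

least : ∀ {P : ℕ → Set} → Decidable P → ∀ {N} → P N → ∃ (Least P)
least P? {N} p with least-below P? (suc N)
... | inj₁ found = found
... | inj₂ none  = ⊥-elim (none N (ℕP.n<1+n N) p)

-- Graphs, colorings and modules

Adj-sym : (G : Graph) → ∀ {u v} → Adj G u v → Adj G v u
Adj-sym G {u} {v} = trans (adj-sym G v u)

Adj⇒≢ : (G : Graph) → ∀ {u v} → Adj G u v → u ≢ v
Adj⇒≢ G {u} u~u refl with () ← trans (sym (adj-irrefl G u)) u~u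

Adj? : (G : Graph) → ∀ u v → Dec (Adj G u v)
Adj? G u v = adj G u v Bool.≟ true

Homomorphism : (G H : Graph) → (Fin (n G) → Fin (n H)) → Set
Homomorphism G H f = ∀ u v → Adj G u v → Adj H (f u) (f v)

CrossProper : (G : Graph) {ℓ : ℕ} → Rel (Fin (n G) → Fin ℓ) 0ℓ
CrossProper G c d = ∀ u v → Adj G u v → c u ≢ d v

module _ (G : Graph) {ℓ : ℕ} where

  crossProper-resp : ∀ {c c′ d d′ : Fin (n G) → Fin ℓ} → c ≗ c′ → d ≗ d′ →
    CrossProper G c d → CrossProper G c′ d′
  crossProper-resp c≗c′ d≗d′ c×d u v u~v e = c×d u v u~v (trans (c≗c′ u) (trans e (sym (d≗d′ v))))

  crossProper-sym : ∀ {c d : Fin (n G) → Fin ℓ} → CrossProper G c d → CrossProper G d c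
  crossProper-sym c×d u v u~v e = c×d v u (Adj-sym G u~v) (sym e)

  isColoring? : ∀ c → Dec (IsColoring G ℓ c)
  isColoring? c = all? λ u → all? λ v → Adj? G u v →-dec ¬? (c u ≟ c v)

  recolor : ∀ {k} {c : Fin (n G) → Fin k} {f : Fin k → Fin ℓ} → Injective _≡_ _≡_ f →
    IsColoring G k c → IsColoring G ℓ (f ∘ c)
  recolor f-injective c-proper u v u~v = c-proper u v u~v ∘ f-injective

crossProper-pullback : ∀ G H {ℓ} {f : Fin (n G) → Fin (n H)} {c d : Fin (n H) → Fin ℓ} →
  Homomorphism G H f → CrossProper H c d → CrossProper G (c ∘ f) (d ∘ f)
crossProper-pullback G H f-hom c×d u v u~v = c×d _ _ (f-hom u v u~v)

colorable? : ∀ G k → Dec (Colorable G k)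
colorable? G k = functions-searchable any? (n G) (λ c≗d → crossProper-resp G c≗d c≗d) (isColoring? G)

chromaticNumber : ∀ G → ∃ (IsChromaticNumber G)
chromaticNumber G = least (colorable? G) (id , λ u v → Adj⇒≢ G)

colorable⇒deficient : ∀ {G χ ℓ} → Colorable G χ → χ < ℓ →
  ∃₂ λ (d : Fin (n G) → Fin ℓ) (unused : Fin ℓ) → IsColoring G ℓ d × (∀ v → d v ≢ unused)
colorable⇒deficient {G} {χ} {ℓ} (c , c-proper) χ<ℓ =
  widen ∘ c , fromℕ< χ<ℓ ,
  recolor G {f = widen} (λ {i} {j} → FinP.inject≤-injective _ _ i j) c-proper , unused
  where
  widen : Fin χ → Fin ℓ
  widen i = inject≤ i (ℕP.<⇒≤ χ<ℓ)
  unused : ∀ v → widen (c v) ≢ fromℕ< χ<ℓ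
  unused v e = ℕP.<⇒≢ (FinP.toℕ<n (c v)) (begin
    toℕ (c v)         ≡⟨ FinP.toℕ-inject≤ (c v) _ ⟨
    toℕ (widen (c v)) ≡⟨ cong toℕ e ⟩
    toℕ (fromℕ< χ<ℓ) ≡⟨ FinP.toℕ-fromℕ< χ<ℓ ⟩
    χ                 ∎)
    where open ≡-Reasoning

nonTrivialModule? : (H : Graph) → Decidable (NonTrivialModule H)
nonTrivialModule? H S =
  ((any? λ v → S v Bool.≟ true) ×-dec
    (all? λ w → (S w Bool.≟ false) →-dec
       ((all? λ s → (S s Bool.≟ true) →-dec Adj? H w s) ⊎-dec
        (all? λ s → (S s Bool.≟ true) →-dec ¬? (Adj? H w s)))))
  ×-dec (any? λ w → S w Bool.≟ false)
  ×-dec (any? λ u → any? λ v → ¬? (u ≟ v) ×-dec (S u Bool.≟ true) ×-dec (S v Bool.≟ true))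

nonTrivialModule-ext : (H : Graph) → Extensional (NonTrivialModule H)
nonTrivialModule-ext H {S} {T} S≗T (((v , v∈) , split) , (w , w∉) , (u₁ , u₂ , u₁≢u₂ , u₁∈ , u₂∈)) =
  ((v , to v∈) , λ x x∉ → Sum.map (λ h s → h s ∘ from) (λ h s → h s ∘ from) (split x (from x∉))) ,
  (w , to w∉) , (u₁ , u₂ , u₁≢u₂ , to u₁∈ , to u₂∈)
  where
  to : ∀ {x b} → S x ≡ b → T x ≡ b
  to {x} = trans (sym (S≗T x))
  from : ∀ {x b} → T x ≡ b → S x ≡ b
  from {x} = trans (S≗T x)

prime⊎nonTrivialModule : ∀ H → Prime H ⊎ ∃ (NonTrivialModule H)
prime⊎nonTrivialModule H
  with functions-searchable Bool-searchable (n H) (nonTrivialModule-ext H) (nonTrivialModule? H)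
... | yes found = inj₂ found
... | no none   = inj₁ λ S S-module → none (S , S-module)

module-homogeneous : ∀ {H S} → IsModule H S →
  ∀ {x y y′} → S x ≡ false → S y ≡ true → S y′ ≡ true → adj H x y ≡ adj H x y′
module-homogeneous (_ , split) {x} x∉S y∈S y′∈S with split x x∉S
... | inj₁ all  = trans (all _ y∈S) (sym (all _ y′∈S))
... | inj₂ none = trans (¬-not (none _ y∈S)) (sym (¬-not (none _ y′∈S)))

-- Reconfiguration through jointly proper colorings

star-first-step : ∀ {A : Set} {R : Rel A 0ℓ} {x y} → Star R x y → x ≢ y → ∃ (R x)
star-first-step ε       x≢x = ⊥-elim (x≢x refl)
star-first-step (r ◅ _) _   = _ , r

module _ {A : Set} {_≈_ R : Rel A 0ℓ}
  (≈-equivalence : IsEquivalence _≈_) (R-resp : R Respects₂ _≈_) where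
  open IsEquivalence ≈-equivalence renaming (refl to ≈-refl; sym to ≈-sym; trans to ≈-trans)

  star-collapse : ∀ {x y} → Star (λ x y → R x y ⊎ x ≈ y) x y → Star R x y ⊎ x ≈ y
  star-collapse ε = inj₂ ≈-refl
  star-collapse (inj₁ r ◅ rest) with star-collapse rest
  ... | inj₁ path = inj₁ (r ◅ path)
  ... | inj₂ y≈z  = inj₁ (proj₁ R-resp y≈z r ◅ ε)
  star-collapse (inj₂ x≈y ◅ rest) with star-collapse rest
  ... | inj₁ ε          = inj₂ x≈y
  ... | inj₁ (r ◅ path) = inj₁ (proj₂ R-resp (≈-sym x≈y) r ◅ path)
  ... | inj₂ y≈z        = inj₂ (≈-trans x≈y y≈z)

moving-injection : ∀ {ℓ} → 2 ≤ ℓ → (i : Fin ℓ) →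
  ∃ λ (σ : Fin ℓ → Fin ℓ) → Injective _≡_ _≡_ σ × σ i ≢ i
moving-injection {ℓ} 2≤ℓ i = transpose i j , injective , moves
  where
  open PermutationComponents using (transpose; transpose-inverse)
  other : 2 ≤ ℓ → (i : Fin ℓ) → ∃ λ j → j ≢ i
  other (s≤s (s≤s _)) zero    = suc zero , λ ()
  other (s≤s (s≤s _)) (suc _) = zero , λ ()
  j : Fin ℓ
  j = proj₁ (other 2≤ℓ i)
  injective : Injective _≡_ _≡_ (transpose i j)
  injective {x} {y} e = begin
    x                                 ≡⟨ transpose-inverse j i ⟨
    transpose j i (transpose i j x)   ≡⟨ cong (transpose j i) e ⟩
    transpose j i (transpose i j y)   ≡⟨ transpose-inverse j i ⟩
    y                                 ∎
    where open ≡-Reasoning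
  moves : transpose i j i ≢ i
  moves with i ≟ i
  ... | yes _   = proj₂ (other 2≤ℓ i)
  ... | no i≢i  = ⊥-elim (i≢i refl)

JointlyProper : (G : Graph) {ℓ : ℕ} → Rel (Fin (n G) → Fin ℓ) 0ℓ
JointlyProper G c d = CrossProper G c c × CrossProper G c d × CrossProper G d d

Linked : (G : Graph) {ℓ : ℕ} → Rel (Fin (n G) → Fin ℓ) 0ℓ
Linked G = Star (JointlyProper G)

linked-pullback : ∀ G H {ℓ} {f : Fin (n G) → Fin (n H)} {c d : Fin (n H) → Fin ℓ} →
  Homomorphism G H f → Linked H c d → Linked G (c ∘ f) (d ∘ f)
linked-pullback G H {f = f} f-hom = gmap (_∘ f) λ (c-proper , c×d , d-proper) →
  pullback c-proper , pullback c×d , pullback d-proper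
  where
  pullback : ∀ {c d} → CrossProper H c d → CrossProper G (c ∘ f) (d ∘ f)
  pullback = crossProper-pullback G H f-hom

module Reconfiguration (G : Graph) (ℓ : ℕ) where

  linked-reverse : ∀ {c d} → Linked G {ℓ} c d → Linked G d c
  linked-reverse = reverse λ (c-proper , c×d , d-proper) → d-proper , crossProper-sym G c×d , c-proper

  ≗⇒jointlyProper : ∀ {c d} → IsColoring G ℓ c → c ≗ d → JointlyProper G c d
  ≗⇒jointlyProper c-proper c≗d =
    c-proper , crossProper-resp G (λ _ → refl) c≗d c-proper , crossProper-resp G c≗d c≗d c-proper

  RAdj⇒jointlyProper : ∀ {x y} → RAdj G ℓ x y → JointlyProper G (proj₁ x) (proj₁ y)
  RAdj⇒jointlyProper {c , c-proper} {d , d-proper} (v , _ , agree) = c-proper , c×d , d-proper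
    where
    c×d : CrossProper G c d
    c×d u w u~w cu≡dw with w ≟ v
    ... | no w≢v   = c-proper u w u~w (trans cu≡dw (sym (agree w w≢v)))
    ... | yes refl = d-proper u w u~w (trans (sym (agree u (Adj⇒≢ G u~w))) cu≡dw)

  mixing⇒linked : Mixing G ℓ → ∀ {c d} → IsColoring G ℓ c → IsColoring G ℓ d → Linked G c d
  mixing⇒linked mixing {c} {d} c-proper d-proper =
    gmap proj₁ (λ {x} {y} → RAdj⇒jointlyProper {x} {y}) (mixing (c , c-proper) (d , d-proper))

  _≈_ : Rel (Coloring G ℓ) 0ℓ
  x ≈ y = proj₁ x ≗ proj₁ y

  ≈-isEquivalence : IsEquivalence _≈_
  ≈-isEquivalence = On.isEquivalence proj₁ (Setoid.isEquivalence (Fin (n G) →-setoid Fin ℓ))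

  RAdj-respʳ : ∀ {x y z} → y ≈ z → RAdj G ℓ x y → RAdj G ℓ x z
  RAdj-respʳ y≈z (v , moved , agree) =
    v , (λ e → moved (trans e (sym (y≈z v)))) , λ u u≢v → trans (agree u u≢v) (y≈z u)

  RAdj-respˡ : ∀ {x y z} → x ≈ y → RAdj G ℓ x z → RAdj G ℓ y z
  RAdj-respˡ x≈y (v , moved , agree) =
    v , (λ e → moved (trans (x≈y v) e)) , λ u u≢v → trans (sym (x≈y u)) (agree u u≢v)

  RAdj-resp : RAdj G ℓ Respects₂ _≈_
  RAdj-resp = (λ {x} {y} {z} → RAdj-respʳ {x} {y} {z}) , (λ {z} {x} {y} → RAdj-respˡ {x} {y} {z})

  RAdj-sym : ∀ {x y} → RAdj G ℓ x y → RAdj G ℓ y x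
  RAdj-sym (v , moved , agree) = v , moved ∘ sym , λ u u≢v → sym (agree u u≢v)

  RAdj⁼ : Rel (Coloring G ℓ) 0ℓ
  RAdj⁼ x y = RAdj G ℓ x y ⊎ x ≈ y

  module Interpolation {c d : Fin (n G) → Fin ℓ}
    (c-proper : IsColoring G ℓ c) (c×d : CrossProper G c d) (d-proper : IsColoring G ℓ d) where

    interpolate : ℕ → Fin (n G) → Fin ℓ
    interpolate m v with toℕ v ℕ.<? m
    ... | yes _ = d v
    ... | no _  = c v

    interpolate-c⊎d : ∀ m v → interpolate m v ≡ c v ⊎ interpolate m v ≡ d v
    interpolate-c⊎d m v with toℕ v ℕ.<? m
    ... | yes _ = inj₂ refl
    ... | no _  = inj₁ refl

    interpolate-cross : ∀ m m′ → CrossProper G (interpolate m) (interpolate m′)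
    interpolate-cross m m′ u v u~v e with interpolate-c⊎d m u | interpolate-c⊎d m′ v
    ... | inj₁ ≡c | inj₁ ≡c′ = c-proper u v u~v (trans (sym ≡c) (trans e ≡c′))
    ... | inj₁ ≡c | inj₂ ≡d′ = c×d u v u~v (trans (sym ≡c) (trans e ≡d′))
    ... | inj₂ ≡d | inj₁ ≡c′ = crossProper-sym G c×d u v u~v (trans (sym ≡d) (trans e ≡c′))
    ... | inj₂ ≡d | inj₂ ≡d′ = d-proper u v u~v (trans (sym ≡d) (trans e ≡d′))

    interpolate-stable : ∀ m u → toℕ u ≢ m → interpolate m u ≡ interpolate (suc m) u
    interpolate-stable m u toℕu≢m with toℕ u ℕ.<? m | toℕ u ℕ.<? suc m
    ... | yes _  | yes _  = refl
    ... | no _   | no _   = refl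
    ... | yes u<m | no u≮1+m = ⊥-elim (u≮1+m (ℕP.m<n⇒m<1+n u<m))
    ... | no u≮m | yes u<1+m = ⊥-elim (toℕu≢m (ℕP.≤-antisym (ℕP.≤-pred u<1+m) (ℕP.≮⇒≥ u≮m)))

    stage : ℕ → Coloring G ℓ
    stage m = interpolate m , interpolate-cross m m

    stage-step : ∀ m → RAdj⁼ (stage m) (stage (suc m))
    stage-step m with any? (λ v → ¬? (interpolate m v ≟ interpolate (suc m) v))
    ... | no none = inj₂ λ v → decidable-stable (interpolate m v ≟ interpolate (suc m) v) (none ∘ (v ,_))
    ... | yes (v , moved) = inj₁ (v , moved , λ u u≢v → interpolate-stable m u (u≢v ∘ index-m⇒v))
      where
      index-m⇒v : ∀ {u} → toℕ u ≡ m → u ≡ v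
      index-m⇒v toℕu≡m = FinP.toℕ-injective (trans toℕu≡m
        (sym (decidable-stable (toℕ v ℕ.≟ m) (moved ∘ interpolate-stable m v))))

    stages : ∀ m → Star RAdj⁼ (stage 0) (stage m)
    stages zero    = ε
    stages (suc m) = stages m ◅◅ (stage-step m ◅ ε)

    last-stage : interpolate (n G) ≗ d
    last-stage v with toℕ v ℕ.<? n G
    ... | yes _   = refl
    ... | no v≮n = ⊥-elim (v≮n (FinP.toℕ<n v))

    reconfigure⁼ : Star RAdj⁼ (c , c-proper) (d , d-proper)
    reconfigure⁼ = inj₂ (λ _ → refl) ◅ stages (n G) ◅◅ (inj₂ last-stage ◅ ε)

  linked⇒reconfigure⁼ : ∀ {c d} → Linked G c d →
    (c-proper : IsColoring G ℓ c) (d-proper : IsColoring G ℓ d) → Star RAdj⁼ (c , c-proper) (d , d-proper)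
  linked⇒reconfigure⁼ ε                          c-proper _ = inj₂ (λ _ → refl) ◅ ε
  linked⇒reconfigure⁼ ((_ , c×e , e-proper) ◅ rest) c-proper d-proper =
    Interpolation.reconfigure⁼ c-proper c×e e-proper ◅◅ linked⇒reconfigure⁼ rest e-proper d-proper

  module _ (linked : ∀ {c d} → IsColoring G ℓ c → IsColoring G ℓ d → Linked G c d) where

    connected⁼ : ∀ x y → Star (RAdj G ℓ) x y ⊎ x ≈ y
    connected⁼ (c , c-proper) (d , d-proper) =
      star-collapse ≈-isEquivalence RAdj-resp
        (linked⇒reconfigure⁼ (linked c-proper d-proper) c-proper d-proper)

    has-neighbour : Fin (n G) → 2 ≤ ℓ → ∀ x → ∃ (RAdj G ℓ x)
    has-neighbour v₀ 2≤ℓ (c , c-proper) with moving-injection 2≤ℓ (c v₀)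
    ... | σ , σ-injective , moves with connected⁼ (c , c-proper) (σ ∘ c , recolor G σ-injective c-proper)
    ...   | inj₁ path = star-first-step path λ e → moves (sym (cong (λ x → proj₁ x v₀) e))
    ...   | inj₂ same = ⊥-elim (moves (sym (same v₀)))

    -- Without function extensionality, pointwise equal colorings need not be equal,
    -- so they are joined by a detour through a neighbour.
    linked⇒mixing : Fin (n G) → 2 ≤ ℓ → Mixing G ℓ
    linked⇒mixing v₀ 2≤ℓ x y with connected⁼ x y | has-neighbour v₀ 2≤ℓ x
    ... | inj₁ path | _         = path
    ... | inj₂ x≈y  | z , x→z  = _◅_ {j = z} x→z (_◅_ {j = y} z→y ε)
      where
      z→y : RAdj G ℓ z y
      z→y = RAdj-respʳ {z} {x} {y} x≈y (RAdj-sym {x} {z} x→z)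

-- Substituting a clique for a module

cast-injective : ∀ {m m′} .(eq : m ≡ m′) → Injective _≡_ _≡_ (cast eq)
cast-injective eq {i} {j} e = FinP.toℕ-injective (begin
  toℕ i           ≡⟨ FinP.toℕ-cast eq i ⟨
  toℕ (cast eq i) ≡⟨ cong toℕ e ⟩
  toℕ (cast eq j) ≡⟨ FinP.toℕ-cast eq j ⟩
  toℕ j           ∎)
  where open ≡-Reasoning

does-≟-sym : ∀ {k} (t t′ : Fin k) → does (t ≟ t′) ≡ does (t′ ≟ t)
does-≟-sym t t′ with t ≟ t′
... | yes t≡t′ = sym (dec-true (t′ ≟ t) (sym t≡t′))
... | no t≢t′  = sym (dec-false (t′ ≟ t) (t≢t′ ∘ sym))

module Substitution (G : Graph) (M : Fin (n G) → Bool) (m₀ : Fin (n G))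
  (homogeneous : ∀ {w u} → M w ≡ false → M u ≡ true → adj G w u ≡ adj G w m₀) where

  inside : Enumeration (λ v → M v ≡ true)
  inside = enumerate (λ v → M v Bool.≟ true)

  outside : Enumeration (λ v → M v ≡ false)
  outside = enumerate (λ v → M v Bool.≟ false)

  module inside = Enumeration inside
  module outside = Enumeration outside

  #in #out : ℕ
  #in  = inside.size
  #out = outside.size

  G[M] : Graph
  G[M] = induced G #in inside.embed

  towards-m₀ : ∀ j i → Adj G (outside.embed j) (inside.embed i) → Adj G (outside.embed j) m₀
  towards-m₀ j i = trans (sym (homogeneous (outside.embed-∈ j) (inside.embed-∈ i)))

  from-m₀ : ∀ {w u} → M w ≡ false → M u ≡ true → Adj G w m₀ → Adj G w u
  from-m₀ w∉M u∈M = trans (homogeneous w∉M u∈M)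

  -- M replaced by a clique on the vertices inj₂ t, t : Fin k
  adjᶜ : ∀ {k} → Fin #out ⊎ Fin k → Fin #out ⊎ Fin k → Bool
  adjᶜ (inj₁ j) (inj₁ j′) = adj G (outside.embed j) (outside.embed j′)
  adjᶜ (inj₁ j) (inj₂ _)  = adj G (outside.embed j) m₀
  adjᶜ (inj₂ _) (inj₁ j)  = adj G (outside.embed j) m₀
  adjᶜ (inj₂ t) (inj₂ t′) = not (does (t ≟ t′))

  adjᶜ-sym : ∀ {k} (x y : Fin #out ⊎ Fin k) → adjᶜ x y ≡ adjᶜ y x
  adjᶜ-sym (inj₁ j) (inj₁ j′) = adj-sym G _ _
  adjᶜ-sym (inj₁ _) (inj₂ _)  = refl
  adjᶜ-sym (inj₂ _) (inj₁ _)  = refl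
  adjᶜ-sym (inj₂ t) (inj₂ t′) = cong not (does-≟-sym t t′)

  adjᶜ-irrefl : ∀ {k} (x : Fin #out ⊎ Fin k) → adjᶜ x x ≡ false
  adjᶜ-irrefl (inj₁ j) = adj-irrefl G _
  adjᶜ-irrefl (inj₂ t) = cong not (dec-true (t ≟ t) refl)

  clique-adj : ∀ {k} {t t′ : Fin k} → t ≢ t′ → adjᶜ {k} (inj₂ t) (inj₂ t′) ≡ true
  clique-adj {t = t} {t′} t≢t′ = cong not (dec-false (t ≟ t′) t≢t′)

  clique-adj⇒≢ : ∀ {k} {t t′ : Fin k} → adjᶜ {k} (inj₂ t) (inj₂ t′) ≡ true → t ≢ t′
  clique-adj⇒≢ {t = t} t~t′ refl with () ← trans (sym (adjᶜ-irrefl (inj₂ t))) t~t′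

  Contracted : ℕ → Graph
  Contracted k = record
    { n          = #out + k
    ; adj        = λ p q → adjᶜ (splitAt #out p) (splitAt #out q)
    ; adj-sym    = λ p q → adjᶜ-sym (splitAt #out p) (splitAt #out q)
    ; adj-irrefl = adjᶜ-irrefl ∘ splitAt #out
    }

  data Side (v : Fin (n G)) : Set where
    inner : ∀ i → inside.embed i ≡ v → Side v
    outer : ∀ j → outside.embed j ≡ v → Side v

  side : ∀ v → Side v
  side v with M v in eq
  ... | true  = inner (inside.index eq) (inside.embed-index eq)
  ... | false = outer (outside.index eq) (outside.embed-index eq)

  projectˢ : ∀ {k} → (Fin #in → Fin k) → ∀ {v} → Side v → Fin #out ⊎ Fin k
  projectˢ ρ (inner i _) = inj₂ (ρ i)
  projectˢ ρ (outer j _) = inj₁ j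

  project : ∀ {k} → (Fin #in → Fin k) → Fin (n G) → Fin (#out + k)
  project {k} ρ v = join #out k (projectˢ ρ (side v))

  splitAt-project : ∀ {k} (ρ : Fin #in → Fin k) v → splitAt #out (project ρ v) ≡ projectˢ ρ (side v)
  splitAt-project {k} ρ v = FinP.splitAt-join #out k (projectˢ ρ (side v))

  project-homomorphism : ∀ {k} {ρ : Fin #in → Fin k} → IsColoring G[M] k ρ →
    Homomorphism G (Contracted k) (project ρ)
  project-homomorphism {k} {ρ} ρ-proper u v u~v
    rewrite splitAt-project ρ u | splitAt-project ρ v = sides (side u) (side v) u~v
    where
    sides : ∀ {u v} (su : Side u) (sv : Side v) → Adj G u v →
      adjᶜ (projectˢ ρ su) (projectˢ ρ sv) ≡ true
    sides (inner i refl) (inner i′ refl) i~i′ = clique-adj (ρ-proper i i′ i~i′)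
    sides (inner i refl) (outer j refl) i~j  = towards-m₀ j i (Adj-sym G i~j)
    sides (outer j refl) (inner i refl) j~i  = towards-m₀ j i j~i
    sides (outer j refl) (outer j′ refl) j~j′ = j~j′

  module Palette {ℓ} {α : Fin (n G) → Fin ℓ} (α-proper : IsColoring G ℓ α) where

    Available : Fin ℓ → Set
    Available x = ∀ w → M w ≡ false → Adj G w m₀ → α w ≢ x

    available : Enumeration Available
    available = enumerate λ x →
      all? λ w → (M w Bool.≟ false) →-dec (Adj? G w m₀ →-dec ¬? (α w ≟ x))

    module available = Enumeration available

    #available : ℕ
    #available = available.size

    inside-available : ∀ {u} → M u ≡ true → Available (α u)
    inside-available u∈M w w∉M w~m₀ = α-proper w _ (from-m₀ w∉M u∈M w~m₀)

    restriction : Fin #in → Fin #available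
    restriction i = available.index (inside-available (inside.embed-∈ i))

    embed-restriction : ∀ i → available.embed (restriction i) ≡ α (inside.embed i)
    embed-restriction i = available.embed-index _

    restriction-proper : IsColoring G[M] #available restriction
    restriction-proper i i′ i~i′ e = α-proper _ _ i~i′ (begin
      α (inside.embed i)                 ≡⟨ embed-restriction i ⟨
      available.embed (restriction i)    ≡⟨ cong available.embed e ⟩
      available.embed (restriction i′)   ≡⟨ embed-restriction i′ ⟩
      α (inside.embed i′)                ∎)
      where open ≡-Reasoning

    χ[M]≤#available : ∀ {k} → IsChromaticNumber G[M] k → k ≤ #available
    χ[M]≤#available (_ , minimal) =
      ℕP.≮⇒≥ λ #available<k → minimal _ #available<k (restriction , restriction-proper)

    extendˢ : (Fin #in → Fin #available) → ∀ {v} → Side v → Fin ℓ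
    extendˢ s     (inner i _) = available.embed (s i)
    extendˢ s {v} (outer _ _) = α v

    extend : (Fin #in → Fin #available) → Fin (n G) → Fin ℓ
    extend s v = extendˢ s (side v)

    extend-cross : ∀ {s s′} → CrossProper G[M] s s′ → CrossProper G (extend s) (extend s′)
    extend-cross {s} {s′} s×s′ u v u~v = sides (side u) (side v) u~v
      where
      sides : ∀ {u v} (su : Side u) (sv : Side v) → Adj G u v → extendˢ s su ≢ extendˢ s′ sv
      sides (inner i refl) (inner i′ refl) i~i′ = s×s′ i i′ i~i′ ∘ available.embed-injective
      sides (inner i refl) (outer j refl) i~j  =
        available.embed-∈ (s i) _ (outside.embed-∈ j) (towards-m₀ j i (Adj-sym G i~j)) ∘ sym
      sides (outer j refl) (inner i refl) j~i  =
        available.embed-∈ (s′ i) _ (outside.embed-∈ j) (towards-m₀ j i j~i)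
      sides (outer j refl) (outer j′ refl) j~j′ = α-proper _ _ j~j′

    extend-linked : ∀ {s s′} → Linked G[M] s s′ → Linked G (extend s) (extend s′)
    extend-linked = gmap extend λ (s-proper , s×s′ , s′-proper) →
      extend-cross s-proper , extend-cross s×s′ , extend-cross s′-proper

    extend-cong : ∀ {s s′} → s ≗ s′ → extend s ≗ extend s′
    extend-cong s≗s′ v with side v
    ... | inner i _ = cong available.embed (s≗s′ i)
    ... | outer _ _ = refl

    extend-restriction : α ≗ extend restriction
    extend-restriction v with side v
    ... | inner i refl = sym (embed-restriction i)
    ... | outer _ _    = refl

    contractˢ : ∀ {k} → (Fin k → Fin #available) → Fin #out ⊎ Fin k → Fin ℓ
    contractˢ σ = [ α ∘ outside.embed , available.embed ∘ σ ]′

    contract : ∀ {k} → (Fin k → Fin #available) → Fin (#out + k) → Fin ℓ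
    contract σ = contractˢ σ ∘ splitAt #out

    contract-proper : ∀ {k} {σ : Fin k → Fin #available} → Injective _≡_ _≡_ σ →
      IsColoring (Contracted k) ℓ (contract σ)
    contract-proper {σ = σ} σ-injective p q = sides (splitAt #out p) (splitAt #out q)
      where
      sides : ∀ x y → adjᶜ x y ≡ true → contractˢ σ x ≢ contractˢ σ y
      sides (inj₁ j) (inj₁ j′) j~j′ = α-proper _ _ j~j′
      sides (inj₁ j) (inj₂ t)  j~t  = available.embed-∈ (σ t) _ (outside.embed-∈ j) j~t
      sides (inj₂ t) (inj₁ j)  t~j  = available.embed-∈ (σ t) _ (outside.embed-∈ j) t~j ∘ sym
      sides (inj₂ t) (inj₂ t′) t~t′ = clique-adj⇒≢ t~t′ ∘ σ-injective ∘ available.embed-injective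

    extend-project : ∀ {k} (σ : Fin k → Fin #available) (ρ : Fin #in → Fin k) →
      extend (σ ∘ ρ) ≗ contract σ ∘ project ρ
    extend-project σ ρ v = trans (sides (side v)) (cong (contractˢ σ) (sym (splitAt-project ρ v)))
      where
      sides : (sv : Side v) → extendˢ (σ ∘ ρ) sv ≡ contractˢ σ (projectˢ ρ sv)
      sides (inner _ _)    = refl
      sides (outer _ refl) = refl

  -- Pulling back d⁎ frees the spare color together with the k clique colors.
  pullback-palette-large : ∀ {k ℓ} {d⁎ : Fin (#out + k) → Fin ℓ}
    (d⁎-proper : IsColoring (Contracted k) ℓ d⁎) {spare : Fin ℓ} → (∀ p → d⁎ p ≢ spare) →
    ∀ {ρ : Fin #in → Fin k} (ρ-proper : IsColoring G[M] k ρ) →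
    k < Palette.#available (crossProper-pullback G (Contracted k) (project-homomorphism ρ-proper) d⁎-proper)
  pullback-palette-large {k} {ℓ} {d⁎} d⁎-proper {spare} d⁎-misses {ρ} ρ-proper =
    available.injective⇒≤size color-injective color-available
    where
    open Palette (crossProper-pullback G (Contracted k) (project-homomorphism ρ-proper) d⁎-proper)
    color : Fin (suc k) → Fin ℓ
    color zero    = spare
    color (suc t) = d⁎ (#out ↑ʳ t)
    color-injective : Injective _≡_ _≡_ color
    color-injective {zero}  {zero}   _ = refl
    color-injective {zero}  {suc _}  e = ⊥-elim (d⁎-misses _ (sym e))
    color-injective {suc _} {zero}   e = ⊥-elim (d⁎-misses _ e)
    color-injective {suc t} {suc t′} e with t ≟ t′
    ... | yes t≡t′ = cong suc t≡t′
    ... | no t≢t′  = ⊥-elim (d⁎-proper _ _ t~t′ e)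
      where
      t~t′ : Adj (Contracted k) (#out ↑ʳ t) (#out ↑ʳ t′)
      t~t′ rewrite FinP.splitAt-↑ʳ #out k t | FinP.splitAt-↑ʳ #out k t′ = clique-adj t≢t′
    color-availableˢ : ∀ x {w} (sw : Side w) → M w ≡ false → Adj G w m₀ →
      d⁎ (join #out k (projectˢ ρ sw)) ≢ color x
    color-availableˢ _       (inner i refl) w∉M _ with () ← trans (sym w∉M) (inside.embed-∈ i)
    color-availableˢ zero    (outer j refl) _ _   = d⁎-misses _
    color-availableˢ (suc t) (outer j refl) _ w~m₀ = d⁎-proper _ _ j~t
      where
      j~t : Adj (Contracted k) (j ↑ˡ k) (#out ↑ʳ t)
      j~t rewrite FinP.splitAt-↑ˡ #out j k | FinP.splitAt-↑ʳ #out k t = w~m₀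
    color-available : ∀ x → Available (color x)
    color-available x w = color-availableˢ x (side w)

  module _ {k} (χ[M] : IsChromaticNumber G[M] k) where

    γ : Fin #in → Fin k
    γ = proj₁ (proj₁ χ[M])

    γ-proper : IsColoring G[M] k γ
    γ-proper = proj₂ (proj₁ χ[M])

    Lifted : ∀ {ℓ} → (Fin (n G) → Fin ℓ) → Set
    Lifted {ℓ} α = ∃ λ d → IsColoring (Contracted k) ℓ d × Linked G α (d ∘ project γ)

    contracted-colorable : ∀ {ℓ} → Colorable G ℓ → Colorable (Contracted k) ℓ
    contracted-colorable (_ , α-proper) =
      contract σ , contract-proper {σ = σ} (λ {t} {t′} → FinP.inject≤-injective _ _ t t′)
      where
      open Palette α-proper
      σ : Fin k → Fin #available
      σ t = inject≤ t (χ[M]≤#available χ[M])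

    contracted-χ : ∀ {χ} → IsChromaticNumber G χ → IsChromaticNumber (Contracted k) χ
    contracted-χ (G-colorable , minimal) = contracted-colorable G-colorable , λ j j<χ (d , d-proper) →
      minimal j j<χ (d ∘ project γ ,
        crossProper-pullback G (Contracted k) (project-homomorphism γ-proper) d-proper)

    module _ (G[M]-recolorable : Recolorable G[M]) where

      large-palette⇒lifted : ∀ {ℓ α} (α-proper : IsColoring G ℓ α) →
        k < Palette.#available α-proper → Lifted α
      large-palette⇒lifted {ℓ} α-proper k<#available =
        contract σ , contract-proper σ-injective ,
        ≗⇒jointlyProper α-proper extend-restriction ◅
        extend-linked restriction~σγ ◅◅
        ≗⇒jointlyProper (extend-cross σγ-proper) (extend-project σ γ) ◅ ε
        where
        open Palette α-proper
        open Reconfiguration G ℓ using (≗⇒jointlyProper)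
        σ : Fin k → Fin #available
        σ t = inject≤ t (ℕP.<⇒≤ k<#available)
        σ-injective : Injective _≡_ _≡_ σ
        σ-injective {t} {t′} = FinP.inject≤-injective _ _ t t′
        σγ-proper : IsColoring G[M] #available (σ ∘ γ)
        σγ-proper = recolor G[M] σ-injective γ-proper
        restriction~σγ : Linked G[M] restriction (σ ∘ γ)
        restriction~σγ = Reconfiguration.mixing⇒linked G[M] #available
          (G[M]-recolorable k #available χ[M] k<#available) restriction-proper σγ-proper

      module _ {ℓ} (mixing : Mixing (Contracted k) ℓ)
        {d⁎ : Fin (#out + k) → Fin ℓ} (d⁎-proper : IsColoring (Contracted k) ℓ d⁎)
        {spare : Fin ℓ} (d⁎-misses : ∀ p → d⁎ p ≢ spare) where

        open Reconfiguration G ℓ using (≗⇒jointlyProper; linked-reverse)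

        -- α factors through Contracted k, where it can be moved to d⁎; that frees a color.
        tight-palette⇒lifted : ∀ {α} (α-proper : IsColoring G ℓ α) →
          Palette.#available α-proper ≡ k → Lifted α
        tight-palette⇒lifted {α} α-proper #available≡k =
          let d , d-proper , α′~d = large-palette⇒lifted α′-proper
                                      (pullback-palette-large d⁎-proper d⁎-misses ρ-proper)
          in d , d-proper ,
             ≗⇒jointlyProper α-proper α≗ ◅ linked-pullback G (Contracted k) ρ-hom σ~d⁎ ◅◅ α′~d
          where
          open Palette α-proper
          ρ : Fin #in → Fin k
          ρ = cast #available≡k ∘ restriction
          ρ-proper : IsColoring G[M] k ρ
          ρ-proper = recolor G[M] (cast-injective #available≡k) restriction-proper
          ρ-hom : Homomorphism G (Contracted k) (project ρ)
          ρ-hom = project-homomorphism ρ-proper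
          σ : Fin k → Fin #available
          σ = cast (sym #available≡k)
          σρ≗restriction : σ ∘ ρ ≗ restriction
          σρ≗restriction i = FinP.cast-involutive (sym #available≡k) #available≡k (restriction i)
          α≗ : α ≗ contract σ ∘ project ρ
          α≗ v = begin
            α v                         ≡⟨ extend-restriction v ⟩
            extend restriction v        ≡⟨ extend-cong σρ≗restriction v ⟨
            extend (σ ∘ ρ) v            ≡⟨ extend-project σ ρ v ⟩
            contract σ (project ρ v)    ∎
            where open ≡-Reasoning
          α′-proper : IsColoring G ℓ (d⁎ ∘ project ρ)
          α′-proper = crossProper-pullback G (Contracted k) ρ-hom d⁎-proper
          σ~d⁎ : Linked (Contracted k) (contract σ) d⁎
          σ~d⁎ = Reconfiguration.mixing⇒linked (Contracted k) ℓ mixing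
            (contract-proper (cast-injective (sym #available≡k))) d⁎-proper

        lifted : ∀ {α} (α-proper : IsColoring G ℓ α) → Lifted α
        lifted α-proper with k ℕ.<? Palette.#available α-proper
        ... | yes k<#available = large-palette⇒lifted α-proper k<#available
        ... | no k≮#available  = tight-palette⇒lifted α-proper
          (ℕP.≤-antisym (ℕP.≮⇒≥ k≮#available) (Palette.χ[M]≤#available α-proper χ[M]))

        linked : ∀ {α β} → IsColoring G ℓ α → IsColoring G ℓ β → Linked G α β
        linked α-proper β-proper =
          let dα , dα-proper , α~dα = lifted α-proper
              dβ , dβ-proper , β~dβ = lifted β-proper
              dα~dβ = Reconfiguration.mixing⇒linked (Contracted k) ℓ mixing dα-proper dβ-proper
          in α~dα ◅◅
             linked-pullback G (Contracted k) (project-homomorphism γ-proper) dα~dβ ◅◅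
             linked-reverse β~dβ

  substitution-recolorable : ∀ {k} → IsChromaticNumber G[M] k → Recolorable G[M] →
    Recolorable (Contracted k) → Recolorable G
  substitution-recolorable {k} χ[M] G[M]-recolorable contracted-recolorable χ ℓ χ-G χ<ℓ =
    let χ-contracted = contracted-χ χ[M] χ-G
        mixing = contracted-recolorable χ ℓ χ-contracted χ<ℓ
        _ , _ , d⁎-proper , d⁎-misses = colorable⇒deficient {Contracted k} (proj₁ χ-contracted) χ<ℓ
    in Reconfiguration.linked⇒mixing G ℓ
         (linked χ[M] G[M]-recolorable mixing d⁎-proper d⁎-misses) m₀ 2≤ℓ
    where
    -- χ ≥ 1 because G has the vertex m₀
    2≤ℓ : 2 ≤ ℓ
    2≤ℓ = ℕP.≤-trans (s≤s (ℕP.≤-trans (s≤s z≤n) (FinP.toℕ<n (proj₁ (proj₁ χ-G) m₀)))) χ<ℓ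

-- Blowups

module Blowup {B H : Graph} (φ : Fin (n B) → Fin (n H)) (φ-onto : ∀ x → ∃ λ u → φ u ≡ x)
  (fibre-clique : ∀ u v → φ u ≡ φ v → u ≢ v → Adj B u v)
  (adj-φ : ∀ u v → φ u ≢ φ v → adj B u v ≡ adj H (φ u) (φ v)) where

  restriction-blowup : ∀ {P : Fin (n H) → Set} (P? : Decidable P) →
    let module E = Enumeration (enumerate P?)
        module F = Enumeration (enumerate (P? ∘ φ))
    in IsBlowupOf (induced B F.size F.embed) (induced H E.size E.embed)
  restriction-blowup {P} P? = ψ , ψ-onto , ψ-clique , ψ-adj
    where
    module E = Enumeration (enumerate P?)
    module F = Enumeration (enumerate (P? ∘ φ))
    ψ : Fin F.size → Fin E.size
    ψ i = E.index (F.embed-∈ i)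
    embed-ψ : ∀ i → E.embed (ψ i) ≡ φ (F.embed i)
    embed-ψ i = E.embed-index _
    ψ≡⇔φ≡ : ∀ {i j} → ψ i ≡ ψ j ⇔ φ (F.embed i) ≡ φ (F.embed j)
    ψ≡⇔φ≡ {i} {j} = mk⇔
      (λ e → trans (sym (embed-ψ i)) (trans (cong E.embed e) (embed-ψ j)))
      (λ e → E.embed-injective (trans (embed-ψ i) (trans e (sym (embed-ψ j)))))
    ψ-onto : ∀ x → ∃ λ i → ψ i ≡ x
    ψ-onto x = let u , φu≡x = φ-onto (E.embed x)
                   φu∈P = subst P (sym φu≡x) (E.embed-∈ x)
               in F.index φu∈P ,
                  E.embed-injective (trans (embed-ψ _) (trans (cong φ (F.embed-index φu∈P)) φu≡x))
    ψ-clique : ∀ i j → ψ i ≡ ψ j → i ≢ j → Adj B (F.embed i) (F.embed j)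
    ψ-clique i j ψi≡ψj i≢j = fibre-clique _ _ (Equivalence.to ψ≡⇔φ≡ ψi≡ψj) (i≢j ∘ F.embed-injective)
    ψ-adj : ∀ i j → ψ i ≢ ψ j → adj B (F.embed i) (F.embed j) ≡ adj H (E.embed (ψ i)) (E.embed (ψ j))
    ψ-adj i j ψi≢ψj = trans (adj-φ _ _ (ψi≢ψj ∘ Equivalence.from ψ≡⇔φ≡))
      (sym (cong₂ (adj H) (embed-ψ i) (embed-ψ j)))

  module Decomposition {S : Fin (n H) → Bool} (S-nontrivial : NonTrivialModule H S) where

    S-module : IsModule H S
    S-module = proj₁ S-nontrivial

    s₀ : Fin (n H)
    s₀ = proj₁ (proj₁ S-module)

    s₀∈S : S s₀ ≡ true
    s₀∈S = proj₂ (proj₁ S-module)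

    m₀ : Fin (n B)
    m₀ = proj₁ (φ-onto s₀)

    φm₀≡s₀ : φ m₀ ≡ s₀
    φm₀≡s₀ = proj₂ (φ-onto s₀)

    M : Fin (n B) → Bool
    M = S ∘ φ

    m₀∈M : M m₀ ≡ true
    m₀∈M = trans (cong S φm₀≡s₀) s₀∈S

    separated : ∀ {x y} → S x ≡ false → S y ≡ true → x ≢ y
    separated x∉S y∈S refl with () ← trans (sym x∉S) y∈S

    M-homogeneous : ∀ {w u} → M w ≡ false → M u ≡ true → adj B w u ≡ adj B w m₀
    M-homogeneous {w} {u} w∉M u∈M = begin
      adj B w u             ≡⟨ adj-φ w u (separated w∉M u∈M) ⟩
      adj H (φ w) (φ u)     ≡⟨ module-homogeneous {H} {S} S-module w∉M u∈M m₀∈M ⟩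
      adj H (φ w) (φ m₀)    ≡⟨ adj-φ w m₀ (separated w∉M m₀∈M) ⟨
      adj B w m₀            ∎
      where open ≡-Reasoning

    open Substitution B M m₀ M-homogeneous public

    module S = Enumeration (enumerate (λ x → S x Bool.≟ true))

    H[S] : Graph
    H[S] = induced H S.size S.embed

    H[S]-smaller : S.size < n H
    H[S]-smaller = let w , w∉S = proj₁ (proj₂ S-nontrivial) in S.size< λ w∈S → separated w∉S w∈S refl

    G[M]-blowup : IsBlowupOf G[M] H[S]
    G[M]-blowup = restriction-blowup (λ x → S x Bool.≟ true)

    -- H with the module S shrunk to its vertex s₀
    Shrunk : Fin (n H) → Set
    Shrunk x = S x ≡ false ⊎ x ≡ s₀

    module Q = Enumeration (enumerate (λ x → (S x Bool.≟ false) ⊎-dec (x ≟ s₀)))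

    H/S : Graph
    H/S = induced H Q.size Q.embed

    another-member : ∃ λ s → S s ≡ true × s ≢ s₀
    another-member with proj₂ (proj₂ S-nontrivial)
    ... | u₁ , u₂ , u₁≢u₂ , u₁∈S , u₂∈S with u₁ ≟ s₀
    ...   | yes u₁≡s₀ = u₂ , u₂∈S , u₁≢u₂ ∘ trans u₁≡s₀ ∘ sym
    ...   | no u₁≢s₀  = u₁ , u₁∈S , u₁≢s₀

    H/S-smaller : Q.size < n H
    H/S-smaller with another-member
    ... | s , s∈S , s≢s₀ = Q.size< {s} λ
      { (inj₁ s∉S)  → separated s∉S s∈S refl
      ; (inj₂ s≡s₀) → s≢s₀ s≡s₀ }

    contracted-blowup : ∀ {k} → Fin k → IsBlowupOf (Contracted k) H/S
    contracted-blowup {k} t₀ = ψ ∘ splitAt #out , ψ-onto , ψ-clique , ψ-adj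
      where
      target : Fin #out ⊎ Fin k → Fin (n H)
      target (inj₁ j) = φ (outside.embed j)
      target (inj₂ _) = s₀

      target-shrunk : ∀ x → Shrunk (target x)
      target-shrunk (inj₁ j) = inj₁ (outside.embed-∈ j)
      target-shrunk (inj₂ _) = inj₂ refl

      ψ : Fin #out ⊎ Fin k → Fin Q.size
      ψ x = Q.index (target-shrunk x)

      embed-ψ : ∀ x → Q.embed (ψ x) ≡ target x
      embed-ψ x = Q.embed-index _

      ψ≡⇔target≡ : ∀ {x y} → ψ x ≡ ψ y ⇔ target x ≡ target y
      ψ≡⇔target≡ {x} {y} = mk⇔
        (λ e → trans (sym (embed-ψ x)) (trans (cong Q.embed e) (embed-ψ y)))
        (λ e → Q.embed-injective (trans (embed-ψ x) (trans e (sym (embed-ψ y)))))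

      preimage : ∀ y → ∃ λ x → target x ≡ Q.embed y
      preimage y with Q.embed-∈ y
      ... | inj₁ y∉S = let u , φu≡y = φ-onto (Q.embed y)
                           u∉M = trans (cong S φu≡y) y∉S
                       in inj₁ (outside.index u∉M) , trans (cong φ (outside.embed-index u∉M)) φu≡y
      ... | inj₂ y≡s₀ = inj₂ t₀ , sym y≡s₀

      ψ-onto : ∀ y → ∃ λ p → ψ (splitAt #out p) ≡ y
      ψ-onto y = let x , target≡ = preimage y in
        join #out k x , trans (cong ψ (FinP.splitAt-join #out k x))
                              (Q.embed-injective (trans (embed-ψ x) target≡))

      clique : ∀ x y → target x ≡ target y → x ≢ y → adjᶜ x y ≡ true
      clique (inj₁ j) (inj₁ j′) φ≡φ  j≢j′ =
        fibre-clique _ _ φ≡φ (j≢j′ ∘ cong inj₁ ∘ outside.embed-injective)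
      clique (inj₁ j) (inj₂ _)  φ≡s₀ _    = ⊥-elim (separated (outside.embed-∈ j) s₀∈S φ≡s₀)
      clique (inj₂ _) (inj₁ j)  s₀≡φ _    = ⊥-elim (separated (outside.embed-∈ j) s₀∈S (sym s₀≡φ))
      clique (inj₂ t) (inj₂ t′) _    t≢t′ = clique-adj (t≢t′ ∘ cong inj₂)

      ψ-clique : ∀ p q → ψ (splitAt #out p) ≡ ψ (splitAt #out q) → p ≢ q → Adj (Contracted k) p q
      ψ-clique p q ψ≡ψ p≢q = clique _ _ (Equivalence.to ψ≡⇔target≡ ψ≡ψ) (p≢q ∘ splitAt-injective)
        where
        splitAt-injective : splitAt #out p ≡ splitAt #out q → p ≡ q
        splitAt-injective e = begin
          p                          ≡⟨ FinP.join-splitAt #out k p ⟨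
          join #out k (splitAt #out p) ≡⟨ cong (join #out k) e ⟩
          join #out k (splitAt #out q) ≡⟨ FinP.join-splitAt #out k q ⟩
          q                          ∎
          where open ≡-Reasoning

      adjacency : ∀ x y → target x ≢ target y → adjᶜ x y ≡ adj H (target x) (target y)
      adjacency (inj₁ j) (inj₁ j′) φ≢φ  = adj-φ _ _ φ≢φ
      adjacency (inj₁ j) (inj₂ _)  φ≢s₀ =
        trans (adj-φ _ m₀ (φ≢s₀ ∘ (λ e → trans e φm₀≡s₀))) (cong (adj H _) φm₀≡s₀)
      adjacency (inj₂ t) (inj₁ j)  s₀≢φ =
        trans (adjacency (inj₁ j) (inj₂ t) (s₀≢φ ∘ sym)) (adj-sym H _ _)
      adjacency (inj₂ _) (inj₂ _)  s₀≢s₀ = ⊥-elim (s₀≢s₀ refl)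

      ψ-adj : ∀ p q → ψ (splitAt #out p) ≢ ψ (splitAt #out q) →
        adj (Contracted k) p q ≡ adj H (Q.embed (ψ (splitAt #out p))) (Q.embed (ψ (splitAt #out q)))
      ψ-adj p q ψ≢ψ = trans (adjacency x y (ψ≢ψ ∘ Equivalence.from ψ≡⇔target≡))
        (sym (cong₂ (adj H) (embed-ψ x) (embed-ψ y)))
        where
        x y : Fin #out ⊎ Fin k
        x = splitAt #out p
        y = splitAt #out q

isBlowupOf-refl : ∀ G → IsBlowupOf G G
isBlowupOf-refl G = id , (_, refl) , (λ _ _ u≡v u≢v → ⊥-elim (u≢v u≡v)) , (λ _ _ _ → refl)

module _ (𝒢 : Graph → Set) (𝒢-hereditary : Hereditary 𝒢)
  (prime-blowups : ∀ H → 𝒢 H → Prime H → ∀ B → IsBlowupOf B H → Recolorable B) where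

  blowups-recolorable : ∀ N H → n H < N → 𝒢 H → ∀ B → IsBlowupOf B H → Recolorable B
  blowups-recolorable (suc N) H |H|<1+N H∈𝒢 B blowup@(φ , φ-onto , fibre-clique , adj-φ)
    with prime⊎nonTrivialModule H
  ... | inj₁ H-prime = prime-blowups H H∈𝒢 H-prime B blowup
  ... | inj₂ (S , S-nontrivial) = substitution-recolorable χ[M]
      (smaller-blowups S.embed H[S]-smaller S.embed-injective G[M] G[M]-blowup)
      (smaller-blowups Q.embed H/S-smaller Q.embed-injective (Contracted k) (contracted-blowup t₀))
    where
    open Blowup {B} {H} φ φ-onto fibre-clique adj-φ
    open Decomposition S-nontrivial
    k : ℕ
    k = proj₁ (chromaticNumber G[M])
    χ[M] : IsChromaticNumber G[M] k
    χ[M] = proj₂ (chromaticNumber G[M])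
    t₀ : Fin k
    t₀ = proj₁ (proj₁ χ[M]) (inside.index m₀∈M)
    smaller-blowups : ∀ {m} (f : Fin m → Fin (n H)) → m < n H → Injective _≡_ _≡_ f →
      ∀ B′ → IsBlowupOf B′ (induced H m f) → Recolorable B′
    smaller-blowups f m<|H| f-injective = blowups-recolorable N (induced H _ f)
      (ℕP.<-≤-trans m<|H| (ℕP.≤-pred |H|<1+N)) (𝒢-hereditary H H∈𝒢 _ f f-injective)

theorem3 : (𝒢 : Graph → Set) → Hereditary 𝒢 →
    (∀ H → 𝒢 H → Prime H → ∀ B → IsBlowupOf B H → Recolorable B) →
    ∀ G → 𝒢 G → Recolorable G
theorem3 𝒢 𝒢-hereditary prime-blowups G G∈𝒢 =
  blowups-recolorable 𝒢 𝒢-hereditary prime-blowups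
    (suc (n G)) G (ℕP.n<1+n (n G)) G∈𝒢 G (isBlowupOf-refl G)
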